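{- Let $k$ be a positive integer and let $G$ be a finite exactly $k$-edge-connected multigraph. Then $G$ has at least two distinct vertices of degree $k$.
   Context: Multigraphs may have parallel edges, and edge sets are multisets. Degrees count incident edges with multiplicity. A multigraph with at least two vertices is exactly $k$-edge-connected if, for any two distinct vertices $u,v$, the maximum number of pairwise edge-disjoint $u$–$v$ paths is exactly $k$. -}

module Defs where

open import Data.Nat using (ℕ; zero; suc; _+_; _≤_)
open import Data.Fin using (Fin; _≟_)
open import Data.Fin.Properties using ()
open import Data.Product using (Σ; ∃; _×_; _,_; proj₁; proj₂)
open import Data.Sum using (_⊎_)
open import Data.List using (List; []; _∷_; map; allFin)
open import Data.Nat.ListAction using (sum)
open import Data.Empty using (⊥)
open import Data.List.Membership.Propositional using (_∈_)
open import Data.List.Relation.Unary.Unique.Propositional using (Unique)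
open import Relation.Binary.PropositionalEquality using (_≡_; _≢_)
open import Relation.Nullary using (¬_; yes; no)

-- A finite loopless multigraph: vertices Fin n, edges Fin m (so parallel
-- edges are distinct edges), each edge has an (ordered) pair of endpoints.
record Multigraph : Set where
  field
    n     : ℕ
    m     : ℕ
    ends  : Fin m → Fin n × Fin n
    loopless : (e : Fin m) → proj₁ (ends e) ≢ proj₂ (ends e)

module _ (G : Multigraph) where
  open Multigraph G

  Joins : Fin m → Fin n → Fin n → Set
  Joins e a b = (ends e ≡ (a , b)) ⊎ (ends e ≡ (b , a))

  data Walk : Fin n → Fin n → Set where
    here : {u : Fin n} → Walk u u
    step : {u w v : Fin n} (e : Fin m) → Joins e u w → Walk w v → Walk u v

  walkVerts : {u v : Fin n} → Walk u v → List (Fin n)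
  walkVerts {u} here = u ∷ []
  walkVerts {u} (step e _ p) = u ∷ walkVerts p

  walkEdges : {u v : Fin n} → Walk u v → List (Fin m)
  walkEdges here = []
  walkEdges (step e _ p) = e ∷ walkEdges p

  Path : Fin n → Fin n → Set
  Path u v = Σ (Walk u v) (λ p → Unique (walkVerts p))

  pathEdges : {u v : Fin n} → Path u v → List (Fin m)
  pathEdges (p , _) = walkEdges p

  EdgeDisjoint : {u v : Fin n} → Path u v → Path u v → Set
  EdgeDisjoint p q = (e : Fin m) → e ∈ pathEdges p → e ∈ pathEdges q → ⊥

  DisjointPaths : ℕ → Fin n → Fin n → Set
  DisjointPaths j u v =
    Σ (Fin j → Path u v) (λ P → (i i' : Fin j) → i ≢ i' → EdgeDisjoint (P i) (P i'))

  ExactlyEdgeConnected : ℕ → Set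
  ExactlyEdgeConnected k =
    2 ≤ n ×
    ((u v : Fin n) → u ≢ v → DisjointPaths k u v × ¬ DisjointPaths (suc k) u v)

  endCount : Fin n → Fin n → ℕ
  endCount v a with a ≟ v
  ... | yes _ = 1
  ... | no _  = 0

  degree : Fin n → ℕ
  degree v = sum (map (λ e → endCount v (proj₁ (ends e)) + endCount v (proj₂ (ends e))) (allFin m))

module Submission where

-- Let d(X) be the number of edges with exactly one end in the vertex set X, so that the
-- degree of v is d({v}); d is symmetric and submodular. By Menger's theorem (via augmenting
-- paths in unit-capacity flows), exact k-edge-connectivity says that every
-- set separating two vertices has d ≥ k and that any two vertices are separated by a set
-- with d ≤ k. Uncrossing such a tight set X with a tight set Y separating two members of X
-- yields a strictly smaller tight set, X ∩ Y or X ∖ Y, so every tight set contains a vertex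
-- of degree k. Applying this to X and then to the complement of the vertex found gives two.

open import Defs
open import Algebra.Properties.CommutativeSemigroup using (interchange)
open import Data.Bool using (Bool; true; false; _∧_; _∨_; _xor_; not)
import Data.Bool.Properties as Bool
open import Data.Empty using (⊥-elim)
open import Data.Fin using (Fin; zero; suc; _≟_)
import Data.Fin.Properties as Finₚ
open import Data.List using (List; []; _∷_)
import Data.List as List
open import Data.List.Membership.Propositional using (_∈_; _∉_)
import Data.List.Relation.Unary.All as All
open import Data.List.Relation.Unary.All.Properties using (¬Any⇒All¬; All¬⇒¬Any)
open import Data.List.Relation.Unary.AllPairs using ([]; _∷_)
open import Data.List.Relation.Unary.Any using (here; there)
open import Data.List.Relation.Unary.Unique.Propositional using (Unique)
open import Data.Nat using (ℕ; zero; suc; _+_; _*_; _∸_; _≤_; _<_; z≤n; s≤s)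
open import Data.Nat.Induction using (<-wellFounded)
import Data.Nat.ListAction as ListAction
open import Data.Nat.Properties hiding (_≟_)
open import Algebra.Properties.Monoid.Sum +-0-monoid using (sum; sum-syntax; sum-cong-≗; sum-replicate-zero)
open import Data.Nat.Tactic.RingSolver using (solve-∀)
open import Data.Product using (Σ; ∃; _×_; _,_; proj₁; proj₂)
import Data.Product as Product
open import Data.Product.Properties using (≡-dec)
open import Data.Sum using (_⊎_; inj₁; inj₂)
open import Data.Vec.Functional using (updateAt)
open import Data.Vec.Functional.Properties using (updateAt-updates; updateAt-minimal)
open import Function using (_∘_; id; const)
open import Function.Definitions using (Injective)
open import Induction.WellFounded using (Acc; acc)
open import Relation.Binary.Definitions using (DecidableEquality)
open import Relation.Binary.PropositionalEquality
open import Relation.Nullary using (¬_; Dec; yes; no; ¬?; does; contradiction)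
open import Relation.Nullary.Decidable using (_×-dec_; dec-true; dec-false)

sum-zero : ∀ {n} {f : Fin n → ℕ} → (∀ i → f i ≡ 0) → sum f ≡ 0
sum-zero {n} f≗0 = trans (sum-cong-≗ f≗0) (sum-replicate-zero n)

sum-ones : ∀ n → ∑[ i < n ] 1 ≡ n
sum-ones zero    = refl
sum-ones (suc n) = cong suc (sum-ones n)

sum-distrib-+ : ∀ {n} (f g : Fin n → ℕ) → ∑[ i < n ] (f i + g i) ≡ sum f + sum g
sum-distrib-+ {zero}  f g = refl
sum-distrib-+ {suc n} f g = trans
  (cong (f zero + g zero +_) (sum-distrib-+ (f ∘ suc) (g ∘ suc)))
  (interchange +-commutativeSemigroup (f zero) (g zero) _ _)

sum-*-distribˡ : ∀ {n} c (f : Fin n → ℕ) → ∑[ i < n ] (c * f i) ≡ c * sum f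
sum-*-distribˡ {zero}  c f = sym (*-zeroʳ c)
sum-*-distribˡ {suc n} c f = trans
  (cong (c * f zero +_) (sum-*-distribˡ c (f ∘ suc)))
  (sym (*-distribˡ-+ c (f zero) _))

sum-mono-≤ : ∀ {n} {f g : Fin n → ℕ} → (∀ i → f i ≤ g i) → sum f ≤ sum g
sum-mono-≤ {zero}  f≤g = z≤n
sum-mono-≤ {suc n} f≤g = +-mono-≤ (f≤g zero) (sum-mono-≤ (f≤g ∘ suc))

sum-mono-< : ∀ {n} {f g : Fin n → ℕ} → (∀ i → f i ≤ g i) → ∀ j → f j < g j → sum f < sum g
sum-mono-< {suc n} f≤g zero    fj<gj = +-mono-<-≤ fj<gj (sum-mono-≤ (f≤g ∘ suc))
sum-mono-< {suc n} f≤g (suc j) fj<gj = +-mono-≤-< (f≤g zero) (sum-mono-< (f≤g ∘ suc) j fj<gj)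

sum-swap : ∀ {n m} (F : Fin n → Fin m → ℕ) → ∑[ i < n ] sum (F i) ≡ ∑[ j < m ] ∑[ i < n ] F i j
sum-swap {zero} {m} F = sym (sum-zero {m} (λ _ → refl))
sum-swap {suc n} F = trans
  (cong (sum (F zero) +_) (sum-swap (F ∘ suc)))
  (sym (sum-distrib-+ (F zero) (λ j → ∑[ i < n ] F (suc i) j)))

sum-weighted-swap : ∀ {n m} (w : Fin n → ℕ) (F : Fin m → Fin n → ℕ) →
  ∑[ v < n ] (w v * ∑[ e < m ] F e v) ≡ ∑[ e < m ] ∑[ v < n ] (w v * F e v)
sum-weighted-swap w F = trans (sum-cong-≗ (λ v → sym (sum-*-distribˡ (w v) (λ e → F e v))))
                              (sum-swap (λ v e → w v * F e v))

sum-except : ∀ {n} (f g : Fin n → ℕ) (e : Fin n) → (∀ i → i ≢ e → f i ≡ g i) →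
             sum f + g e ≡ sum g + f e
sum-except {suc n} f g zero f≗g =
  trans (cong (λ s → f zero + s + g zero) (sum-cong-≗ (λ i → f≗g (suc i) λ ())))
        (rotate (f zero) (sum (g ∘ suc)) (g zero))
  where
  rotate : ∀ a b c → a + b + c ≡ c + b + a
  rotate = solve-∀
sum-except {suc n} f g (suc e) f≗g = begin
  f zero + sum (f ∘ suc) + g (suc e)     ≡⟨ +-assoc (f zero) _ _ ⟩
  f zero + (sum (f ∘ suc) + g (suc e))   ≡⟨ cong₂ _+_ (f≗g zero λ ()) (sum-except (f ∘ suc) (g ∘ suc) e
                                              λ i i≢e → f≗g (suc i) (i≢e ∘ Finₚ.suc-injective)) ⟩
  g zero + (sum (g ∘ suc) + f (suc e))   ≡⟨ +-assoc (g zero) _ _ ⟨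
  g zero + sum (g ∘ suc) + f (suc e)     ∎
  where open ≡-Reasoning

sum-allFin : ∀ {m} (g : Fin m → ℕ) → ListAction.sum (List.map g (List.allFin m)) ≡ sum g
sum-allFin g = go g id
  where
  go : ∀ {m} {A : Set} (g : A → ℕ) (h : Fin m → A) →
       ListAction.sum (List.map g (List.tabulate h)) ≡ ∑[ i < m ] g (h i)
  go {zero}  g h = refl
  go {suc m} g h = cong (g (h zero) +_) (go g (h ∘ suc))

𝕀 : Bool → ℕ
𝕀 true  = 1
𝕀 false = 0

-- Subsets of Fin n as characteristic functions, so that membership computes.
Subset : ℕ → Set
Subset n = Fin n → Bool

⁅_⁆ : ∀ {n} → Fin n → Subset n
⁅ a ⁆ v = does (v ≟ a)

∁ : ∀ {n} → Subset n → Subset n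
∁ X v = not (X v)

infixr 7 _∩_ _∪_ _─_
infix 4 _⊆_

_∩_ _∪_ _─_ : ∀ {n} → Subset n → Subset n → Subset n
(X ∩ Y) v = X v ∧ Y v
(X ∪ Y) v = X v ∨ Y v
(X ─ Y) v = X v ∧ not (Y v)

_⊆_ : ∀ {n} → Subset n → Subset n → Set
X ⊆ Y = ∀ v → X v ≡ true → Y v ≡ true

∣_∣ : ∀ {n} → Subset n → ℕ
∣ X ∣ = sum (𝕀 ∘ X)

Separates : ∀ {n} → Subset n → Fin n → Fin n → Set
Separates X u v = X u ≡ true × X v ≡ false

δ : ∀ {n} → Fin n → Fin n → ℕ
δ a v = 𝕀 (⁅ a ⁆ v)

separates⇒≢ : ∀ {n} {X : Subset n} {u v} → Separates X u v → u ≢ v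
separates⇒≢ (Xu , Xv) refl = contradiction (trans (sym Xu) Xv) λ ()

⁅⁆-self : ∀ {n} (a : Fin n) → ⁅ a ⁆ a ≡ true
⁅⁆-self a = dec-true (a ≟ a) refl

⁅⁆-other : ∀ {n} {a v : Fin n} → v ≢ a → ⁅ a ⁆ v ≡ false
⁅⁆-other {a = a} {v} = dec-false (v ≟ a)

⁅⁆⇒≡ : ∀ {n} {a v : Fin n} → ⁅ a ⁆ v ≡ true → v ≡ a
⁅⁆⇒≡ {a = a} {v} v∈a with v ≟ a
... | yes v≡a = v≡a
... | no _    = contradiction v∈a λ ()

∁⁅⁆⇒≢ : ∀ {n} {a v : Fin n} → ∁ ⁅ a ⁆ v ≡ true → v ≢ a
∁⁅⁆⇒≢ {a = a} v∉a refl = contradiction (trans (sym (cong not (⁅⁆-self a))) v∉a) λ ()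

≗⁅⁆ : ∀ {n} {X : Subset n} {a} → X a ≡ true → ¬ (∃ λ v → v ≢ a × X v ≡ true) → X ≗ ⁅ a ⁆
≗⁅⁆ {X = X} {a} Xa alone v with v ≟ a
... | yes refl = Xa
... | no v≢a   = Bool.¬-not (λ Xv → alone (v , v≢a , Xv))

∩-⊆ˡ : ∀ {n} (X Y : Subset n) → X ∩ Y ⊆ X
∩-⊆ˡ X Y v = Bool.∧-conicalˡ (X v) (Y v)

─-⊆ : ∀ {n} (X Y : Subset n) → X ─ Y ⊆ X
─-⊆ X Y v = Bool.∧-conicalˡ (X v) (not (Y v))

∣∣≤n : ∀ {n} (X : Subset n) → ∣ X ∣ ≤ n
∣∣≤n {n} X = subst (∣ X ∣ ≤_) (sum-ones n) (sum-mono-≤ (𝕀≤1 ∘ X))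
  where
  𝕀≤1 : ∀ x → 𝕀 x ≤ 1
  𝕀≤1 false = z≤n
  𝕀≤1 true  = ≤-refl

∣∣<∣∣ : ∀ {n} {X Y : Subset n} {w} → X ⊆ Y → Y w ≡ true → X w ≡ false → ∣ X ∣ < ∣ Y ∣
∣∣<∣∣ {X = X} {Y} {w} X⊆Y Yw Xw = sum-mono-< (λ v → 𝕀-mono (X⊆Y v)) w
  (subst₂ (λ x y → 𝕀 x < 𝕀 y) (sym Xw) (sym Yw) ≤-refl)
  where
  𝕀-mono : ∀ {x y} → (x ≡ true → y ≡ true) → 𝕀 x ≤ 𝕀 y
  𝕀-mono {false} _   = z≤n
  𝕀-mono {true}  x⇒y = ≤-reflexive (cong 𝕀 (sym (x⇒y refl)))

sum-pick : ∀ {n} a (g : Fin n → ℕ) → ∑[ v < n ] (g v * δ a v) ≡ g a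
sum-pick {suc n} zero g = begin
  g zero * 1 + ∑[ v < n ] (g (suc v) * 0)
    ≡⟨ cong₂ _+_ (*-identityʳ (g zero)) (sum-zero (λ v → *-zeroʳ (g (suc v)))) ⟩
  g zero + 0                                ≡⟨ +-identityʳ (g zero) ⟩
  g zero                                    ∎
  where open ≡-Reasoning
sum-pick {suc n} (suc a) g =
  trans (cong (_+ ∑[ v < n ] (g (suc v) * δ a v)) (*-zeroʳ (g zero))) (sum-pick a (g ∘ suc))

sum-δ : ∀ {n} (a : Fin n) → ∑[ v < n ] δ a v ≡ 1
sum-δ a = trans (sum-cong-≗ (λ v → sym (*-identityˡ (δ a v)))) (sum-pick a (λ _ → 1))

injection-count : ∀ {m k} (X : Subset m) (f : Fin k → Fin m) → Injective _≡_ _≡_ f →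
                  (∀ i → X (f i) ≡ true) → k ≤ ∣ X ∣
injection-count {m} {k} X f f-inj f∈X = begin
  k                                 ≡⟨ sum-ones k ⟨
  ∑[ i < k ] 1                      ≡⟨ sum-cong-≗ (sum-δ ∘ f) ⟨
  ∑[ i < k ] ∑[ e < m ] δ (f i) e   ≡⟨ sum-swap (δ ∘ f) ⟩
  ∑[ e < m ] ∑[ i < k ] δ (f i) e   ≤⟨ sum-mono-≤ (fibre≤ f f-inj f∈X) ⟩
  ∣ X ∣                             ∎
  where
  open ≤-Reasoning
  fibre≤ : ∀ {k} (f : Fin k → Fin m) → Injective _≡_ _≡_ f → (∀ i → X (f i) ≡ true) →
           ∀ e → ∑[ i < k ] δ (f i) e ≤ 𝕀 (X e)
  fibre≤ {zero}  f f-inj f∈X e = z≤n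
  fibre≤ {suc k} f f-inj f∈X e with e ≟ f zero
  ... | no _     = fibre≤ (f ∘ suc) (Finₚ.suc-injective ∘ f-inj) (f∈X ∘ suc) e
  ... | yes refl rewrite f∈X zero | sum-zero {k} (λ i → cong 𝕀 (dec-false (f zero ≟ f (suc i)) (Finₚ.0≢1+n ∘ f-inj)))
                 = ≤-refl

-- Symmetric submodular set functions

module SymmetricSubmodular
  {n : ℕ} (f : Subset n → ℕ)
  (f-cong : ∀ {X Y} → X ≗ Y → f X ≡ f Y)
  (f-∁ : ∀ X → f (∁ X) ≡ f X)
  (f-submodular : ∀ X Y → f (X ∩ Y) + f (X ∪ Y) ≤ f X + f Y)
  where

  f-posimodular : ∀ X Y → f (X ─ Y) + f (Y ─ X) ≤ f X + f Y
  f-posimodular X Y = begin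
    f (X ─ Y) + f (Y ─ X)        ≡⟨ cong (f (X ∩ ∁ Y) +_) (trans (f-cong Y─X≗∁[X∪∁Y]) (f-∁ _)) ⟩
    f (X ∩ ∁ Y) + f (X ∪ ∁ Y)    ≤⟨ f-submodular X (∁ Y) ⟩
    f X + f (∁ Y)                ≡⟨ cong (f X +_) (f-∁ Y) ⟩
    f X + f Y                    ∎
    where
    open ≤-Reasoning
    Y─X≗∁[X∪∁Y] : (Y ─ X) ≗ ∁ (X ∪ ∁ Y)
    Y─X≗∁[X∪∁Y] v with X v | Y v
    ... | true  | _     = Bool.∧-zeroʳ _
    ... | false | true  = refl
    ... | false | false = refl

  module _
    (k : ℕ)
    (separating⇒≥ : ∀ X {u v} → Separates X u v → k ≤ f X)
    (separate : ∀ {u v} → u ≢ v → ∃ λ X → Separates X u v × f X ≤ k)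
    where

    private
      half : ∀ {a b} → a + b ≤ k + k → k ≤ b → a ≤ k
      half {a} a+b≤2k k≤b = +-cancelʳ-≤ k a k (≤-trans (+-monoʳ-≤ a k≤b) a+b≤2k)

    tight-∩ : ∀ {X Y a c} → f X ≤ k → f Y ≤ k → Separates (X ∪ Y) a c → f (X ∩ Y) ≤ k
    tight-∩ {X} {Y} fX≤k fY≤k sep =
      half (≤-trans (f-submodular X Y) (+-mono-≤ fX≤k fY≤k)) (separating⇒≥ (X ∪ Y) sep)

    tight-─ : ∀ {X Y a c} → f X ≤ k → f Y ≤ k → Separates (Y ─ X) a c → f (X ─ Y) ≤ k
    tight-─ {X} {Y} fX≤k fY≤k sep =
      half (≤-trans (f-posimodular X Y) (+-mono-≤ fX≤k fY≤k)) (separating⇒≥ (Y ─ X) sep)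

    -- Induction on ∣ X ∣: take another member v and a tight Y containing a but not v. If some c
    -- lies outside X ∪ Y then X ∩ Y is tight by submodularity; otherwise b ∈ Y, and X ─ Y is
    -- tight by posimodularity. Both are proper subsets of X.
    tight-singleton : ∀ X {a b} → Separates X a b → f X ≤ k → ∃ λ w → X w ≡ true × f ⁅ w ⁆ ≤ k
    tight-singleton X = go X (<-wellFounded ∣ X ∣)
      where
      within : ∀ {X} Z → Z ⊆ X → (∃ λ u → Z u ≡ true × f ⁅ u ⁆ ≤ k) →
               ∃ λ u → X u ≡ true × f ⁅ u ⁆ ≤ k
      within Z Z⊆X (u , Zu , fu≤k) = u , Z⊆X u Zu , fu≤k
      go : ∀ X → Acc _<_ ∣ X ∣ → ∀ {a b} → Separates X a b → f X ≤ k →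
           ∃ λ w → X w ≡ true × f ⁅ w ⁆ ≤ k
      go X (acc smaller) {a} {b} (Xa , Xb) fX≤k
        with Finₚ.any? (λ v → ¬? (v ≟ a) ×-dec (X v Bool.≟ true))
      ... | no alone = a , Xa , subst (_≤ k) (f-cong (≗⁅⁆ Xa alone)) fX≤k
      ... | yes (v , v≢a , Xv) with separate (v≢a ∘ sym)
      ...   | Y , (Ya , Yv) , fY≤k with Finₚ.any? (λ c → (X c Bool.≟ false) ×-dec (Y c Bool.≟ false))
      ...     | yes (c , Xc , Yc) =
                within (X ∩ Y) (∩-⊆ˡ X Y)
                  (go (X ∩ Y) (smaller (∣∣<∣∣ (∩-⊆ˡ X Y) Xv (cong₂ _∧_ Xv Yv)))
                      (cong₂ _∧_ Xa Ya , cong₂ _∧_ Xc Yc)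
                      (tight-∩ fX≤k fY≤k (cong (_∨ Y a) Xa , cong₂ _∨_ Xc Yc)))
      ...     | no covered =
                within (X ─ Y) (─-⊆ X Y)
                  (go (X ─ Y) (smaller (∣∣<∣∣ (─-⊆ X Y) Xa (cong₂ minus Xa Ya)))
                      (cong₂ minus Xv Yv , cong₂ minus Xa Ya)
                      (tight-─ fX≤k fY≤k (cong₂ minus Yb Xb , cong₂ minus Ya Xa)))
        where
        minus : Bool → Bool → Bool
        minus x y = x ∧ not y
        Yb : Y b ≡ true
        Yb = Bool.¬-not (λ Yb≡false → covered (b , Xb , Yb≡false))

    two-tight-singletons : ∀ {u v} → u ≢ v →
      ∃ λ w → ∃ λ w′ → w ≢ w′ × f ⁅ w ⁆ ≤ k × f ⁅ w′ ⁆ ≤ k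
    two-tight-singletons {u} {v} u≢v =
      let X , X-sep , fX≤k  = separate u≢v
          w , _ , fw≤k      = tight-singleton X X-sep fX≤k
          x , x≢w           = distinct-from w
          w′ , w′∉w , fw′≤k = tight-singleton (∁ ⁅ w ⁆) {x} {w}
                                (cong not (⁅⁆-other x≢w) , cong not (⁅⁆-self w))
                                (subst (_≤ k) (sym (f-∁ ⁅ w ⁆)) fw≤k)
      in w , w′ , (λ w≡w′ → ∁⁅⁆⇒≢ w′∉w (sym w≡w′)) , fw≤k , fw′≤k
      where
      distinct-from : ∀ w → ∃ λ x → x ≢ w
      distinct-from w with u ≟ w
      ... | yes refl = v , u≢v ∘ sym
      ... | no u≢w   = u , u≢w

data Chain {V E : Set} (Step : E → V → V → Set) : V → V → Set where
  []  : ∀ {u} → Chain Step u u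
  _∷_ : ∀ {e u w v} → Step e u w → Chain Step w v → Chain Step u v

module _ {V E : Set} {Step : E → V → V → Set} where

  vertices : ∀ {u v} → Chain Step u v → List V
  vertices {u} []      = u ∷ []
  vertices {u} (_ ∷ p) = u ∷ vertices p

  edges : ∀ {u v} → Chain Step u v → List E
  edges []            = []
  edges (_∷_ {e} _ p) = e ∷ edges p

  _∷ʳ_ : ∀ {e u w v} → Chain Step u w → Step e w v → Chain Step u v
  []      ∷ʳ s = s ∷ []
  (s′ ∷ p) ∷ʳ s = s′ ∷ (p ∷ʳ s)

  step-on : ∀ {u v e} (p : Chain Step u v) → e ∈ edges p → ∃ λ a → ∃ λ b → Step e a b
  step-on (s ∷ p) (here refl) = _ , _ , s
  step-on (s ∷ p) (there e∈p) = step-on p e∈p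

  module _ (_≟ᵥ_ : DecidableEquality V) where
    open import Data.List.Membership.DecPropositional _≟ᵥ_ using (_∈?_)

    suffix : ∀ {u w v} (p : Chain Step w v) → u ∈ vertices p → Unique (vertices p) →
             Σ (Chain Step u v) (Unique ∘ vertices)
    suffix []      (here refl) uniq       = [] , uniq
    suffix (s ∷ p) (here refl) uniq       = s ∷ p , uniq
    suffix (s ∷ p) (there u∈p) (_ ∷ uniq) = suffix p u∈p uniq

    shortcut : ∀ {u v} → Chain Step u v → Σ (Chain Step u v) (Unique ∘ vertices)
    shortcut []            = [] , (All.[] ∷ [])
    shortcut {u} (s ∷ p) with shortcut p
    ... | q , uniq with u ∈? vertices q
    ...   | yes u∈q = suffix q u∈q uniq
    ...   | no u∉q  = s ∷ q , (¬Any⇒All¬ _ u∉q ∷ uniq)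

Closed : ∀ {n m} → (Fin m → Fin n → Fin n → Set) → Subset n → Set
Closed Step R = ∀ {e a b} → R a ≡ true → Step e a b → R b ≡ true

module Search {n m : ℕ} (Step : Fin m → Fin n → Fin n → Set)
  (step? : ∀ e a b → Dec (Step e a b)) where

  chain-or-closed : ∀ s t → Chain Step s t ⊎ ∃ λ R → Separates R s t × Closed Step R
  chain-or-closed s t =
    grow ⁅ s ⁆ (<-wellFounded _) (⁅⁆-self s) (λ s∈ → subst (Chain Step s) (sym (⁅⁆⇒≡ s∈)) [])
    where
    grow : ∀ R → Acc _<_ (n ∸ ∣ R ∣) → R s ≡ true → (∀ {v} → R v ≡ true → Chain Step s v) →
           Chain Step s t ⊎ ∃ λ R → Separates R s t × Closed Step R
    grow R (acc smaller) Rs reach with R t Bool.≟ true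
    ... | yes Rt = inj₁ (reach Rt)
    ... | no Rt≢true with Finₚ.any? (λ e → Finₚ.any? λ a → Finₚ.any? λ b →
                            (R a Bool.≟ true) ×-dec (R b Bool.≟ false) ×-dec step? e a b)
    ...   | no stuck = inj₂ (R , (Rs , Bool.¬-not Rt≢true) , closed)
      where
      closed : Closed Step R
      closed {e} {a} {b} Ra st with R b Bool.≟ true
      ... | yes Rb = Rb
      ... | no Rb≢true = contradiction (e , a , b , Ra , Bool.¬-not Rb≢true , st) stuck
    ...   | yes (e , a , b , Ra , Rb , st) =
            grow (R ∪ ⁅ b ⁆) (smaller (∸-monoʳ-< ∣R∣<∣R′∣ (∣∣≤n (R ∪ ⁅ b ⁆))))
                 (cong (_∨ ⁅ b ⁆ s) Rs) reach′
      where
      ∣R∣<∣R′∣ : ∣ R ∣ < ∣ R ∪ ⁅ b ⁆ ∣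
      ∣R∣<∣R′∣ = ∣∣<∣∣ (λ v Rv → cong (_∨ ⁅ b ⁆ v) Rv)
                      (trans (cong (R b ∨_) (⁅⁆-self b)) (Bool.∨-zeroʳ (R b))) Rb
      reach′ : ∀ {v} → (R ∪ ⁅ b ⁆) v ≡ true → Chain Step s v
      reach′ {v} R′v with v ≟ b
      ... | yes refl = reach Ra ∷ʳ st
      ... | no _     = reach (trans (sym (Bool.∨-identityʳ (R v))) R′v)

-- Cuts and paths in a multigraph

crossing-submodular : ∀ a b c d →
  𝕀 ((a ∧ c) xor (b ∧ d)) + 𝕀 ((a ∨ c) xor (b ∨ d)) ≤ 𝕀 (a xor b) + 𝕀 (c xor d)
crossing-submodular true  true  c     d     = ≤-reflexive (+-identityʳ _)
crossing-submodular false false c     d     = ≤-refl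
crossing-submodular true  false true  true  = ≤ᵇ⇒≤ _ _ _
crossing-submodular true  false true  false = ≤ᵇ⇒≤ _ _ _
crossing-submodular true  false false true  = ≤ᵇ⇒≤ _ _ _
crossing-submodular true  false false false = ≤ᵇ⇒≤ _ _ _
crossing-submodular false true  true  true  = ≤ᵇ⇒≤ _ _ _
crossing-submodular false true  true  false = ≤ᵇ⇒≤ _ _ _
crossing-submodular false true  false true  = ≤ᵇ⇒≤ _ _ _
crossing-submodular false true  false false = ≤ᵇ⇒≤ _ _ _

module Cuts (G : Multigraph) where
  open Multigraph G

  end₁ end₂ : Fin m → Fin n
  end₁ e = proj₁ (ends e)
  end₂ e = proj₂ (ends e)

  crosses : Subset n → Fin m → Bool
  crosses X e = X (end₁ e) xor X (end₂ e)

  cut : Subset n → ℕ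
  cut X = ∑[ e < m ] 𝕀 (crosses X e)

  cut-cong : ∀ {X Y} → X ≗ Y → cut X ≡ cut Y
  cut-cong X≗Y = sum-cong-≗ λ e → cong₂ (λ x y → 𝕀 (x xor y)) (X≗Y (end₁ e)) (X≗Y (end₂ e))

  cut-∁ : ∀ X → cut (∁ X) ≡ cut X
  cut-∁ X = sum-cong-≗ λ e → cong 𝕀 (not-xor-not (X (end₁ e)) (X (end₂ e)))
    where
    not-xor-not : ∀ x y → not x xor not y ≡ x xor y
    not-xor-not true  y = refl
    not-xor-not false y = Bool.not-involutive y

  cut-submodular : ∀ X Y → cut (X ∩ Y) + cut (X ∪ Y) ≤ cut X + cut Y
  cut-submodular X Y = begin
    cut (X ∩ Y) + cut (X ∪ Y)
      ≡⟨ sum-distrib-+ (𝕀 ∘ crosses (X ∩ Y)) (𝕀 ∘ crosses (X ∪ Y)) ⟨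
    ∑[ e < m ] (𝕀 (crosses (X ∩ Y) e) + 𝕀 (crosses (X ∪ Y) e))
      ≤⟨ sum-mono-≤ per-edge ⟩
    ∑[ e < m ] (𝕀 (crosses X e) + 𝕀 (crosses Y e))
      ≡⟨ sum-distrib-+ (𝕀 ∘ crosses X) (𝕀 ∘ crosses Y) ⟩
    cut X + cut Y
      ∎
    where
    open ≤-Reasoning
    per-edge : ∀ e → 𝕀 (crosses (X ∩ Y) e) + 𝕀 (crosses (X ∪ Y) e) ≤ 𝕀 (crosses X e) + 𝕀 (crosses Y e)
    per-edge e = crossing-submodular (X (end₁ e)) (X (end₂ e)) (Y (end₁ e)) (Y (end₂ e))

  degree≡cut : ∀ v → degree G v ≡ cut ⁅ v ⁆
  degree≡cut v =
    trans (sum-allFin (λ e → endCount G v (end₁ e) + endCount G v (end₂ e))) (sum-cong-≗ incident)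
    where
    endCount≡ : ∀ a → endCount G v a ≡ 𝕀 (⁅ v ⁆ a)
    endCount≡ a with a ≟ v
    ... | yes _ = refl
    ... | no _  = refl
    incident : ∀ e → endCount G v (end₁ e) + endCount G v (end₂ e) ≡ 𝕀 (crosses ⁅ v ⁆ e)
    incident e rewrite endCount≡ (end₁ e) | endCount≡ (end₂ e)
      with ⁅ v ⁆ (end₁ e) in x∈v | ⁅ v ⁆ (end₂ e) in y∈v
    ... | true  | true  = contradiction (trans (⁅⁆⇒≡ x∈v) (sym (⁅⁆⇒≡ y∈v))) (loopless e)
    ... | true  | false = refl
    ... | false | true  = refl
    ... | false | false = refl

  walk-crosses : ∀ {X u v} → Separates X u v → (p : Walk G u v) →
                 ∃ λ e → e ∈ walkEdges G p × crosses X e ≡ true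
  walk-crosses (Xu , Xv) here = contradiction (trans (sym Xu) Xv) λ ()
  walk-crosses {X} (Xu , Xv) (step {w = w} e joins p) with X w Bool.≟ true
  ... | yes Xw = let e′ , e′∈p , e′-crosses = walk-crosses (Xw , Xv) p in e′ , there e′∈p , e′-crosses
  ... | no Xw≢true = e , here refl , joins-crosses joins
    where
    joins-crosses : Joins G e _ w → crosses X e ≡ true
    joins-crosses (inj₁ ends≡) rewrite ends≡ | Xu | Bool.¬-not Xw≢true = refl
    joins-crosses (inj₂ ends≡) rewrite ends≡ | Xu | Bool.¬-not Xw≢true = refl

  disjointPaths⇒≤cut : ∀ {k X u v} → DisjointPaths G k u v → Separates X u v → k ≤ cut X
  disjointPaths⇒≤cut {X = X} (P , disjoint) sep =
    injection-count (crosses X) (proj₁ ∘ crossing) crossing-injective (proj₂ ∘ proj₂ ∘ crossing)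
    where
    crossing : ∀ i → ∃ λ e → e ∈ pathEdges G (P i) × crosses X e ≡ true
    crossing i = walk-crosses sep (proj₁ (P i))
    crossing-injective : Injective _≡_ _≡_ (proj₁ ∘ crossing)
    crossing-injective {i} {j} same with i ≟ j
    ... | yes i≡j = i≡j
    ... | no i≢j  = contradiction (subst (_∈ pathEdges G (P j)) (sym same) (proj₁ (proj₂ (crossing j))))
                                  (disjoint i j i≢j _ (proj₁ (proj₂ (crossing i))))

module Paths (G : Multigraph) where
  open Multigraph G

  head∈ : ∀ {u v} (p : Walk G u v) → u ∈ walkVerts G p
  head∈ here         = here refl
  head∈ (step _ _ _) = here refl

  ends∈walk : ∀ {u v e} (p : Walk G u v) → e ∈ walkEdges G p →
              proj₁ (ends e) ∈ walkVerts G p × proj₂ (ends e) ∈ walkVerts G p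
  ends∈walk (step e (inj₁ ends≡) p) (here refl) rewrite ends≡ = here refl , there (head∈ p)
  ends∈walk (step e (inj₂ ends≡) p) (here refl) rewrite ends≡ = there (head∈ p) , here refl
  ends∈walk (step e _ p)             (there e∈p) = Product.map there there (ends∈walk p e∈p)

  -- An edge through u whose both ends lie on the rest of the walk would revisit u.
  unique-vertices⇒unique-edges : ∀ {u v} (p : Walk G u v) → Unique (walkVerts G p) → Unique (walkEdges G p)
  unique-vertices⇒unique-edges here         _            = []
  unique-vertices⇒unique-edges (step e joins p) (u∉p ∷ uniq) =
    ¬Any⇒All¬ _ (repeated joins) ∷ unique-vertices⇒unique-edges p uniq
    where
    repeated : Joins G e _ _ → e ∉ walkEdges G p
    repeated (inj₁ ends≡) e∈p =
      All¬⇒¬Any u∉p (subst (_∈ walkVerts G p) (cong proj₁ ends≡) (proj₁ (ends∈walk p e∈p)))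
    repeated (inj₂ ends≡) e∈p =
      All¬⇒¬Any u∉p (subst (_∈ walkVerts G p) (cong proj₂ ends≡) (proj₂ (ends∈walk p e∈p)))

  module _ {Step : Fin m → Fin n → Fin n → Set} (step⇒joins : ∀ {e a b} → Step e a b → Joins G e a b) where

    toWalk : ∀ {u v} → Chain Step u v → Walk G u v
    toWalk []      = here
    toWalk (s ∷ p) = step _ (step⇒joins s) (toWalk p)

    toWalk-vertices : ∀ {u v} (p : Chain Step u v) → walkVerts G (toWalk p) ≡ vertices p
    toWalk-vertices []          = refl
    toWalk-vertices {u} (_ ∷ p) = cong (u ∷_) (toWalk-vertices p)

    toWalk-edges : ∀ {u v} (p : Chain Step u v) → walkEdges G (toWalk p) ≡ edges p
    toWalk-edges []            = refl
    toWalk-edges (_∷_ {e} _ p) = cong (e ∷_) (toWalk-edges p)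

    chain-unique-edges : ∀ {u v} (p : Chain Step u v) → Unique (vertices p) → Unique (edges p)
    chain-unique-edges p uniq = subst Unique (toWalk-edges p)
      (unique-vertices⇒unique-edges (toWalk p) (subst Unique (sym (toWalk-vertices p)) uniq))

    toPath : ∀ {u v} (p : Chain Step u v) → Unique (vertices p) → Path G u v
    toPath p uniq = toWalk p , subst Unique (sym (toWalk-vertices p)) uniq

-- Unit-capacity flows and Menger's theorem

module Flows (G : Multigraph) where
  open Multigraph G
  open Cuts G

  data Dir : Set where
    none fwd bwd : Dir

  -- Each edge carries one unit from its first end to its second (fwd), the other way (bwd), or nothing.
  Flow : Set
  Flow = Fin m → Dir

  tail-at head-at : Dir → Fin m → Fin n → ℕ
  tail-at none e v = 0
  tail-at fwd  e v = δ (end₁ e) v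
  tail-at bwd  e v = δ (end₂ e) v
  head-at none e v = 0
  head-at fwd  e v = δ (end₂ e) v
  head-at bwd  e v = δ (end₁ e) v

  outflow inflow : Flow → Fin n → ℕ
  outflow D v = ∑[ e < m ] tail-at (D e) e v
  inflow  D v = ∑[ e < m ] head-at (D e) e v

  -- Conservation everywhere, with surplus r at s and deficit r at t, stated without subtraction.
  record IsFlow (s t : Fin n) (r : ℕ) (D : Flow) : Set where
    constructor conserves
    field balance : ∀ v → outflow D v + r * δ t v ≡ inflow D v + r * δ s v

  -- D′ carries one unit more than D from a to b.
  record Push (D : Flow) (a b : Fin n) (D′ : Flow) : Set where
    constructor pushes
    field shift : ∀ v → outflow D′ v + inflow D v + δ b v ≡ outflow D v + inflow D′ v + δ a v

  -- Traversing e from a to b in the residual graph changes its direction from d to d′.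
  data Residual (e : Fin m) : Dir → Fin n → Fin n → Dir → Set where
    push-fwd   : ∀ {a b} → ends e ≡ (a , b) → Residual e none a b fwd
    push-bwd   : ∀ {a b} → ends e ≡ (b , a) → Residual e none a b bwd
    cancel-fwd : ∀ {a b} → ends e ≡ (b , a) → Residual e fwd  a b none
    cancel-bwd : ∀ {a b} → ends e ≡ (a , b) → Residual e bwd  a b none

  ResidualStep : Flow → Fin m → Fin n → Fin n → Set
  ResidualStep D e a b = ∃ (Residual e (D e) a b)

  -- D sends a unit along e from a to b exactly when pushing along e from a to b turns none into D e.
  Carries : Flow → Fin m → Fin n → Fin n → Set
  Carries D e a b = Residual e none a b (D e)

  residual⇒joins : ∀ {e d a b d′} → Residual e d a b d′ → Joins G e a b
  residual⇒joins (push-fwd   p) = inj₁ p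
  residual⇒joins (push-bwd   p) = inj₂ p
  residual⇒joins (cancel-fwd p) = inj₂ p
  residual⇒joins (cancel-bwd p) = inj₁ p

  carried⇒≢none : ∀ {e a b d} → Residual e none a b d → d ≢ none
  carried⇒≢none (push-fwd _) ()
  carried⇒≢none (push-bwd _) ()

  private
    ends≟ : ∀ e a b → Dec (ends e ≡ (a , b))
    ends≟ e a b = ≡-dec _≟_ _≟_ (ends e) (a , b)

  residual? : ∀ D e a b → Dec (ResidualStep D e a b)
  residual? D e a b with D e | ends≟ e a b | ends≟ e b a
  ... | none | yes p | _     = yes (fwd , push-fwd p)
  ... | none | no _  | yes q = yes (bwd , push-bwd q)
  ... | none | no ¬p | no ¬q = no λ { (_ , push-fwd p) → ¬p p ; (_ , push-bwd q) → ¬q q }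
  ... | fwd  | _     | yes q = yes (none , cancel-fwd q)
  ... | fwd  | _     | no ¬q = no λ { (_ , cancel-fwd q) → ¬q q }
  ... | bwd  | yes p | _     = yes (none , cancel-bwd p)
  ... | bwd  | no ¬p | _     = no λ { (_ , cancel-bwd p) → ¬p p }

  carries? : ∀ D e a b → Dec (Carries D e a b)
  carries? D e a b with D e | ends≟ e a b | ends≟ e b a
  ... | none | _     | _     = no λ ()
  ... | fwd  | yes p | _     = yes (push-fwd p)
  ... | fwd  | no ¬p | _     = no λ { (push-fwd p) → ¬p p }
  ... | bwd  | _     | yes q = yes (push-bwd q)
  ... | bwd  | _     | no ¬q = no λ { (push-bwd q) → ¬q q }

  push-single : ∀ {D D′ e a b} → Residual e (D e) a b (D′ e) → (∀ e′ → e′ ≢ e → D′ e′ ≡ D e′) →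
                Push D a b D′
  push-single {D} {D′} {e} {a} {b} res agree = pushes shift
    where
    shift : ∀ v → outflow D′ v + inflow D v + δ b v ≡ outflow D v + inflow D′ v + δ a v
    shift v = +-cancelʳ-≡ (t + h′) _ _ (begin
      outflow D′ v + inflow D v + δ b v + (t + h′)      ≡⟨ shuffle₁ (outflow D′ v) (inflow D v) (δ b v) t h′ ⟩
      (outflow D′ v + t) + (inflow D v + h′) + δ b v    ≡⟨ cong₂ (λ o i → o + i + δ b v) out-except in-except ⟩
      (outflow D v + t′) + (inflow D′ v + h) + δ b v    ≡⟨ shuffle₂ (outflow D v) t′ (inflow D′ v) h (δ b v) ⟩
      outflow D v + inflow D′ v + (t′ + h + δ b v)      ≡⟨ cong (outflow D v + inflow D′ v +_) (local-shift res) ⟩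
      outflow D v + inflow D′ v + (t + h′ + δ a v)      ≡⟨ shuffle₃ (outflow D v) (inflow D′ v) t h′ (δ a v) ⟩
      outflow D v + inflow D′ v + δ a v + (t + h′)      ∎)
      where
      open ≡-Reasoning
      t t′ h h′ : ℕ
      t  = tail-at (D e) e v
      t′ = tail-at (D′ e) e v
      h  = head-at (D e) e v
      h′ = head-at (D′ e) e v
      out-except : outflow D′ v + t ≡ outflow D v + t′
      out-except = sum-except (λ e′ → tail-at (D′ e′) e′ v) (λ e′ → tail-at (D e′) e′ v) e
                              (λ e′ e′≢e → cong (λ d → tail-at d e′ v) (agree e′ e′≢e))
      in-except : inflow D v + h′ ≡ inflow D′ v + h
      in-except = sum-except (λ e′ → head-at (D e′) e′ v) (λ e′ → head-at (D′ e′) e′ v) e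
                             (λ e′ e′≢e → cong (λ d → head-at d e′ v) (sym (agree e′ e′≢e)))
      local-shift : ∀ {d d′} → Residual e d a b d′ →
                    tail-at d′ e v + head-at d e v + δ b v ≡ tail-at d e v + head-at d′ e v + δ a v
      local-shift (push-fwd   p) rewrite p = trans (cong (_+ δ b v) (+-identityʳ (δ a v))) (+-comm (δ a v) (δ b v))
      local-shift (push-bwd   p) rewrite p = trans (cong (_+ δ b v) (+-identityʳ (δ a v))) (+-comm (δ a v) (δ b v))
      local-shift (cancel-fwd p) rewrite p =
        trans (+-comm (δ a v) (δ b v)) (cong (_+ δ a v) (sym (+-identityʳ (δ b v))))
      local-shift (cancel-bwd p) rewrite p =
        trans (+-comm (δ a v) (δ b v)) (cong (_+ δ a v) (sym (+-identityʳ (δ b v))))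
      shuffle₁ : ∀ o′ i y t h′ → o′ + i + y + (t + h′) ≡ (o′ + t) + (i + h′) + y
      shuffle₁ = solve-∀
      shuffle₂ : ∀ o t′ i′ h y → (o + t′) + (i′ + h) + y ≡ o + i′ + (t′ + h + y)
      shuffle₂ = solve-∀
      shuffle₃ : ∀ o i′ t h′ x → o + i′ + (t + h′ + x) ≡ o + i′ + x + (t + h′)
      shuffle₃ = solve-∀

  push-trans : ∀ {X Y Z a w b} → Push X a w Y → Push Y w b Z → Push X a b Z
  push-trans {X} {Y} {Z} {a} {w} {b} (pushes X→Y) (pushes Y→Z) =
    pushes λ v → +-cancelʳ-≡ (outflow Y v + inflow Y v + δ w v) _ _
    (trans (shuffle (outflow Z v) (inflow X v) (δ b v) (outflow Y v) (inflow Y v) (δ w v))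
    (trans (cong₂ _+_ (X→Y v) (Y→Z v))
           (shuffle′ (outflow X v) (inflow Y v) (δ a v) (outflow Y v) (inflow Z v) (δ w v))))
    where
    shuffle : ∀ oZ iX b oY iY w → oZ + iX + b + (oY + iY + w) ≡ (oY + iX + w) + (oZ + iY + b)
    shuffle = solve-∀
    shuffle′ : ∀ oX iY a oY iZ w → (oX + iY + a) + (oY + iZ + w) ≡ oX + iZ + a + (oY + iY + w)
    shuffle′ = solve-∀

  push-trans′ : ∀ {X Y Z a w b} → Push X w b Y → Push Y a w Z → Push X a b Z
  push-trans′ {X} {Y} {Z} {a} {w} {b} (pushes X→Y) (pushes Y→Z) =
    pushes λ v → +-cancelʳ-≡ (outflow Y v + inflow Y v + δ w v) _ _
    (trans (shuffle (outflow Z v) (inflow X v) (δ b v) (outflow Y v) (inflow Y v) (δ w v))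
    (trans (cong₂ _+_ (X→Y v) (Y→Z v))
           (shuffle′ (outflow X v) (inflow Y v) (δ w v) (outflow Y v) (inflow Z v) (δ a v))))
    where
    shuffle : ∀ oZ iX b oY iY w → oZ + iX + b + (oY + iY + w) ≡ (oY + iX + b) + (oZ + iY + w)
    shuffle = solve-∀
    shuffle′ : ∀ oX iY w oY iZ a → (oX + iY + w) + (oY + iZ + a) ≡ oX + iZ + a + (oY + iY + w)
    shuffle′ = solve-∀

  isFlow-push : ∀ {s t r D D′} → IsFlow s t r D → Push D s t D′ → IsFlow s t (suc r) D′
  isFlow-push {s} {t} {r} {D} {D′} (conserves flow) (pushes push) =
    conserves λ v → +-cancelʳ-≡ (inflow D v) _ _ (begin
    outflow D′ v + (δ t v + r * δ t v) + inflow D v      ≡⟨ shuffle₁ (outflow D′ v) (δ t v) (r * δ t v) (inflow D v) ⟩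
    (outflow D′ v + inflow D v + δ t v) + r * δ t v      ≡⟨ cong (_+ r * δ t v) (push v) ⟩
    (outflow D v + inflow D′ v + δ s v) + r * δ t v      ≡⟨ shuffle₂ (outflow D v) (inflow D′ v) (δ s v) (r * δ t v) ⟩
    (outflow D v + r * δ t v) + (inflow D′ v + δ s v)    ≡⟨ cong (_+ (inflow D′ v + δ s v)) (flow v) ⟩
    (inflow D v + r * δ s v) + (inflow D′ v + δ s v)     ≡⟨ shuffle₃ (inflow D v) (r * δ s v) (inflow D′ v) (δ s v) ⟩
    inflow D′ v + (δ s v + r * δ s v) + inflow D v       ∎)
    where
    open ≡-Reasoning
    shuffle₁ : ∀ o t rt i → o + (t + rt) + i ≡ (o + i + t) + rt
    shuffle₁ = solve-∀
    shuffle₂ : ∀ o i′ s rt → (o + i′ + s) + rt ≡ (o + rt) + (i′ + s)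
    shuffle₂ = solve-∀
    shuffle₃ : ∀ i rs i′ s → (i + rs) + (i′ + s) ≡ i′ + (s + rs) + i
    shuffle₃ = solve-∀

  isFlow-pop : ∀ {s t r D D′} → IsFlow s t (suc r) D → Push D′ s t D → IsFlow s t r D′
  isFlow-pop {s} {t} {r} {D} {D′} (conserves flow) (pushes push) =
    conserves λ v → +-cancelʳ-≡ (inflow D v + δ s v) _ _ (begin
    outflow D′ v + r * δ t v + (inflow D v + δ s v)      ≡⟨ shuffle₁ (outflow D′ v) (r * δ t v) (inflow D v) (δ s v) ⟩
    (outflow D′ v + inflow D v + δ s v) + r * δ t v      ≡⟨ cong (_+ r * δ t v) (push v) ⟨
    (outflow D v + inflow D′ v + δ t v) + r * δ t v      ≡⟨ shuffle₂ (outflow D v) (inflow D′ v) (δ t v) (r * δ t v) ⟩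
    (outflow D v + (δ t v + r * δ t v)) + inflow D′ v    ≡⟨ cong (_+ inflow D′ v) (flow v) ⟩
    (inflow D v + (δ s v + r * δ s v)) + inflow D′ v     ≡⟨ shuffle₃ (inflow D v) (δ s v) (r * δ s v) (inflow D′ v) ⟩
    inflow D′ v + r * δ s v + (inflow D v + δ s v)       ∎)
    where
    open ≡-Reasoning
    shuffle₁ : ∀ o′ rt i s → o′ + rt + (i + s) ≡ (o′ + i + s) + rt
    shuffle₁ = solve-∀
    shuffle₂ : ∀ o i′ t rt → (o + i′ + t) + rt ≡ (o + (t + rt)) + i′
    shuffle₂ = solve-∀
    shuffle₃ : ∀ i s rs i′ → (i + (s + rs)) + i′ ≡ i′ + rs + (i + s)
    shuffle₃ = solve-∀

  augment : ∀ {D a b} (p : Chain (ResidualStep D) a b) → Unique (edges p) →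
            ∃ λ D′ → Push D a b D′ × (∀ e → e ∉ edges p → D′ e ≡ D e)
  augment []                         _            = _ , pushes (λ v → refl) , (λ _ _ → refl)
  augment {D} (_∷_ {e} (d′ , res) p) (e∉p ∷ uniq) with augment p uniq
  ... | D₁ , push₁ , agree₁ = D₂ , push-trans′ push₁ (push-single res₁ agree₂₁) , agree₂
    where
    D₂ : Flow
    D₂ = updateAt D₁ e (const d′)
    res₁ : Residual e (D₁ e) _ _ (D₂ e)
    res₁ = subst₂ (λ d d″ → Residual e d _ _ d″)
                  (sym (agree₁ e (All¬⇒¬Any e∉p))) (sym (updateAt-updates e D₁)) res
    agree₂₁ : ∀ e′ → e′ ≢ e → D₂ e′ ≡ D₁ e′
    agree₂₁ e′ = updateAt-minimal e′ e D₁
    agree₂ : ∀ e′ → e′ ∉ e ∷ edges p → D₂ e′ ≡ D e′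
    agree₂ e′ e′∉ = trans (agree₂₁ e′ (e′∉ ∘ here)) (agree₁ e′ (e′∉ ∘ there))

  drain : ∀ {D a b} (p : Chain (Carries D) a b) → Unique (edges p) →
          ∃ λ D′ → Push D′ a b D × (∀ e → e ∉ edges p → D′ e ≡ D e) ×
                   (∀ e → e ∈ edges p → D′ e ≡ none)
  drain []                      _            = _ , pushes (λ v → refl) , (λ _ _ → refl) , (λ _ ())
  drain {D} (_∷_ {e} carried p) (e∉p ∷ uniq) with drain p uniq
  ... | D₁ , push₁ , agree₁ , emptied₁ =
        D₂ , push-trans (push-single res₂ agree₁₂) push₁ , agree₂ , emptied₂
    where
    D₂ : Flow
    D₂ = updateAt D₁ e (const none)
    res₂ : Residual e (D₂ e) _ _ (D₁ e)
    res₂ = subst₂ (λ d d″ → Residual e d _ _ d″)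
                  (sym (updateAt-updates e D₁)) (sym (agree₁ e (All¬⇒¬Any e∉p))) carried
    agree₁₂ : ∀ e′ → e′ ≢ e → D₁ e′ ≡ D₂ e′
    agree₁₂ e′ e′≢e = sym (updateAt-minimal e′ e D₁ e′≢e)
    agree₂ : ∀ e′ → e′ ∉ e ∷ edges p → D₂ e′ ≡ D e′
    agree₂ e′ e′∉ = trans (updateAt-minimal e′ e D₁ (e′∉ ∘ here)) (agree₁ e′ (e′∉ ∘ there))
    emptied₂ : ∀ e′ → e′ ∈ e ∷ edges p → D₂ e′ ≡ none
    emptied₂ _  (here refl)  = updateAt-updates e D₁
    emptied₂ e′ (there e′∈p) =
      trans (updateAt-minimal e′ e D₁ λ { refl → All¬⇒¬Any e∉p e′∈p }) (emptied₁ e′ e′∈p)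

  tail-in head-in : Subset n → Dir → Fin m → ℕ
  tail-in R none e = 0
  tail-in R fwd  e = 𝕀 (R (end₁ e))
  tail-in R bwd  e = 𝕀 (R (end₂ e))
  head-in R none e = 0
  head-in R fwd  e = 𝕀 (R (end₂ e))
  head-in R bwd  e = 𝕀 (R (end₁ e))

  private
    restrict : ∀ (R : Subset n) (at : Dir → Fin m → Fin n → ℕ) (in-R : Dir → Fin m → ℕ) →
               (∀ d e → ∑[ v < n ] (𝕀 (R v) * at d e v) ≡ in-R d e) →
               ∀ (D : Flow) → ∑[ v < n ] (𝕀 (R v) * ∑[ e < m ] at (D e) e v) ≡ ∑[ e < m ] in-R (D e) e
    restrict R at in-R at≡ D =
      trans (sum-weighted-swap (𝕀 ∘ R) (λ e → at (D e) e)) (sum-cong-≗ (λ e → at≡ (D e) e))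

    weigh : ∀ (R : Subset n) r a → ∑[ v < n ] (𝕀 (R v) * (r * δ a v)) ≡ 𝕀 (R a) * r
    weigh R r a =
      trans (sum-cong-≗ (λ v → sym (*-assoc (𝕀 (R v)) r (δ a v)))) (sum-pick a (λ v → 𝕀 (R v) * r))

    tail-in-sum : ∀ R d e → ∑[ v < n ] (𝕀 (R v) * tail-at d e v) ≡ tail-in R d e
    tail-in-sum R none e = sum-zero {n} (λ v → *-zeroʳ (𝕀 (R v)))
    tail-in-sum R fwd  e = sum-pick (end₁ e) (𝕀 ∘ R)
    tail-in-sum R bwd  e = sum-pick (end₂ e) (𝕀 ∘ R)

    head-in-sum : ∀ R d e → ∑[ v < n ] (𝕀 (R v) * head-at d e v) ≡ head-in R d e
    head-in-sum R none e = sum-zero {n} (λ v → *-zeroʳ (𝕀 (R v)))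
    head-in-sum R fwd  e = sum-pick (end₂ e) (𝕀 ∘ R)
    head-in-sum R bwd  e = sum-pick (end₁ e) (𝕀 ∘ R)

    split : ∀ R (g : Fin n → ℕ) r a →
            ∑[ v < n ] (𝕀 (R v) * (g v + r * δ a v)) ≡ ∑[ v < n ] (𝕀 (R v) * g v) + 𝕀 (R a) * r
    split R g r a = trans (sum-cong-≗ (λ v → *-distribˡ-+ (𝕀 (R v)) (g v) (r * δ a v)))
                          (trans (sum-distrib-+ (λ v → 𝕀 (R v) * g v) (λ v → 𝕀 (R v) * (r * δ a v)))
                                 (cong (∑[ v < n ] (𝕀 (R v) * g v) +_) (weigh R r a)))

  flow-across : ∀ {s t r D R} → IsFlow s t r D → Separates R s t →
                ∑[ e < m ] tail-in R (D e) e ≡ ∑[ e < m ] head-in R (D e) e + r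
  flow-across {s} {t} {r} {D} {R} (conserves flow) (Rs , Rt) = begin
    ∑[ e < m ] tail-in R (D e) e                      ≡⟨ restrict R tail-at (tail-in R) (tail-in-sum R) D ⟨
    Out                                               ≡⟨ +-identityʳ Out ⟨
    Out + 𝕀 false * r                                 ≡⟨ cong (λ x → Out + 𝕀 x * r) Rt ⟨
    Out + 𝕀 (R t) * r                                 ≡⟨ split R (outflow D) r t ⟨
    ∑[ v < n ] (𝕀 (R v) * (outflow D v + r * δ t v))  ≡⟨ sum-cong-≗ (λ v → cong (𝕀 (R v) *_) (flow v)) ⟩
    ∑[ v < n ] (𝕀 (R v) * (inflow D v + r * δ s v))   ≡⟨ split R (inflow D) r s ⟩
    In + 𝕀 (R s) * r                                  ≡⟨ cong (λ x → In + 𝕀 x * r) Rs ⟩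
    In + 1 * r                                        ≡⟨ cong₂ _+_ (restrict R head-at (head-in R) (head-in-sum R) D)
                                                                   (*-identityˡ r) ⟩
    ∑[ e < m ] head-in R (D e) e + r                  ∎
    where
    open ≡-Reasoning
    Out In : ℕ
    Out = ∑[ v < n ] (𝕀 (R v) * outflow D v)
    In  = ∑[ v < n ] (𝕀 (R v) * inflow D v)

  private
    escapes : ∀ {x : Bool} {A : Set} → x ≡ true → x ≡ false → A
    escapes x≡true x≡false = contradiction (trans (sym x≡true) x≡false) λ ()

  residual-closed-edge : ∀ {R e} d → (∀ {a b d′} → R a ≡ true → Residual e d a b d′ → R b ≡ true) →
                         tail-in R d e ≡ head-in R d e + 𝕀 (crosses R e)
  residual-closed-edge {R} {e} none closed with R (end₁ e) in Rx | R (end₂ e) in Ry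
  ... | true  | true  = refl
  ... | false | false = refl
  ... | true  | false = escapes (closed Rx (push-fwd refl)) Ry
  ... | false | true  = escapes (closed Ry (push-bwd refl)) Rx
  residual-closed-edge {R} {e} fwd closed with R (end₁ e) in Rx | R (end₂ e) in Ry
  ... | true  | true  = refl
  ... | true  | false = refl
  ... | false | false = refl
  ... | false | true  = escapes (closed Ry (cancel-fwd refl)) Rx
  residual-closed-edge {R} {e} bwd closed with R (end₁ e) in Rx | R (end₂ e) in Ry
  ... | true  | true  = refl
  ... | false | true  = refl
  ... | false | false = refl
  ... | true  | false = escapes (closed Rx (cancel-bwd refl)) Ry

  carried-closed-edge : ∀ {R e} d → (∀ {a b} → R a ≡ true → Residual e none a b d → R b ≡ true) →
                        tail-in R d e ≤ head-in R d e
  carried-closed-edge none closed = z≤n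
  carried-closed-edge {R} {e} fwd closed with R (end₁ e) in Rx | R (end₂ e) in Ry
  ... | false | _     = z≤n
  ... | true  | true  = ≤-refl
  ... | true  | false = escapes (closed Rx (push-fwd refl)) Ry
  carried-closed-edge {R} {e} bwd closed with R (end₁ e) in Rx | R (end₂ e) in Ry
  ... | _     | false = z≤n
  ... | true  | true  = ≤-refl
  ... | false | true  = escapes (closed Ry (push-bwd refl)) Rx

  residual-closed⇒cut≡value : ∀ {s t r D R} → IsFlow s t r D → Separates R s t →
                              Closed (ResidualStep D) R → cut R ≡ r
  residual-closed⇒cut≡value {s} {t} {r} {D} {R} flow sep closed = +-cancelˡ-≡ In _ _ (begin
    In + cut R                                        ≡⟨ sum-distrib-+ (λ e → head-in R (D e) e) (𝕀 ∘ crosses R) ⟨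
    ∑[ e < m ] (head-in R (D e) e + 𝕀 (crosses R e))  ≡⟨ sum-cong-≗ per-edge ⟨
    ∑[ e < m ] tail-in R (D e) e                      ≡⟨ flow-across {s} {t} {r} {D} {R} flow sep ⟩
    In + r                                            ∎)
    where
    open ≡-Reasoning
    In : ℕ
    In = ∑[ e < m ] head-in R (D e) e
    per-edge : ∀ e → tail-in R (D e) e ≡ head-in R (D e) e + 𝕀 (crosses R e)
    per-edge e = residual-closed-edge (D e) (λ Ra r → closed Ra (_ , r))

  carries-not-closed : ∀ {s t r D R} → IsFlow s t (suc r) D → Separates R s t → ¬ Closed (Carries D) R
  carries-not-closed {s} {t} {r} {D} {R} flow sep closed = <⇒≱
    (subst (∑[ e < m ] head-in R (D e) e <_) (sym (flow-across {s} {t} {suc r} {D} {R} flow sep))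
           (m<m+n _ (s≤s z≤n)))
    (sum-mono-≤ (λ e → carried-closed-edge (D e) closed))

module Menger (G : Multigraph) where
  open Multigraph G
  open Cuts G
  open Paths G
  open Flows G

  module _ (s t : Fin n) where

    -- Augment along a residual s–t path; if there is none, the vertices reachable from s
    -- form a cut of size r.
    flow-or-cut : ∀ r → ∃ (IsFlow s t r) ⊎ ∃ λ R → Separates R s t × cut R < r
    flow-or-cut zero = inj₁ ((λ _ → none) , conserves λ v → refl)
    flow-or-cut (suc r) with flow-or-cut r
    ... | inj₂ (R , sep , cut<r) = inj₂ (R , sep , m<n⇒m<1+n cut<r)
    ... | inj₁ (D , flow) with Search.chain-or-closed (ResidualStep D) (residual? D) s t
    ...   | inj₂ (R , sep , closed) =
            inj₂ (R , sep , ≤-reflexive (cong suc (residual-closed⇒cut≡value flow sep closed)))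
    ...   | inj₁ p with shortcut _≟_ p
    ...     | q , uniq with augment q (chain-unique-edges (λ (_ , r) → residual⇒joins r) q uniq)
    ...       | D′ , push , _ = inj₁ (D′ , isFlow-push flow push)

    -- Peel off one carried s–t path at a time.
    decompose : ∀ r {D} → IsFlow s t r D →
                Σ (DisjointPaths G r s t) λ P → ∀ i {e} → e ∈ pathEdges G (proj₁ P i) → D e ≢ none
    decompose zero    _ = ((λ ()) , λ ()) , λ ()
    decompose (suc r) {D} flow with Search.chain-or-closed (Carries D) (carries? D) s t
    ... | inj₂ (R , sep , closed) = ⊥-elim (carries-not-closed {D = D} {R = R} flow sep closed)
    ... | inj₁ p with shortcut _≟_ p
    ...   | q , uniq with drain q (chain-unique-edges residual⇒joins q uniq)
    ...     | D′ , pop , agree , emptied with decompose r (isFlow-pop flow pop)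
    ...       | (Q , Q-disjoint) , Q-uses = (P , P-disjoint) , P-uses
      where
      on-q : ∀ {e} → e ∈ walkEdges G (toWalk residual⇒joins q) → e ∈ edges q
      on-q = subst (_ ∈_) (toWalk-edges residual⇒joins q)
      q-uses : ∀ {e} → e ∈ edges q → D e ≢ none
      q-uses e∈q = carried⇒≢none (proj₂ (proj₂ (step-on q e∈q)))
      P : Fin (suc r) → Path G s t
      P zero    = toPath residual⇒joins q uniq
      P (suc i) = Q i
      P-disjoint : ∀ i j → i ≢ j → EdgeDisjoint G (P i) (P j)
      P-disjoint zero    zero    0≢0 = contradiction refl 0≢0
      P-disjoint zero    (suc j) _   e e∈q e∈Q = Q-uses j e∈Q (emptied e (on-q e∈q))
      P-disjoint (suc i) zero    _   e e∈Q e∈q = Q-uses i e∈Q (emptied e (on-q e∈q))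
      P-disjoint (suc i) (suc j) i≢j = Q-disjoint i j (i≢j ∘ cong suc)
      P-uses : ∀ i {e} → e ∈ pathEdges G (P i) → D e ≢ none
      P-uses zero    e∈q = q-uses (on-q e∈q)
      P-uses (suc i) {e} e∈Q De≡none =
        Q-uses i e∈Q (trans (agree e (λ e∈q → q-uses e∈q De≡none)) De≡none)

    menger : ∀ k → ¬ DisjointPaths G (suc k) s t → ∃ λ R → Separates R s t × cut R ≤ k
    menger k no-paths with flow-or-cut (suc k)
    ... | inj₂ (R , sep , cut≤k) = R , sep , ≤-pred cut≤k
    ... | inj₁ (D , flow)        = contradiction (proj₁ (decompose (suc k) flow)) no-paths

two-distinct : ∀ {n} → 2 ≤ n → ∃ λ (u : Fin n) → ∃ λ v → u ≢ v
two-distinct (s≤s (s≤s _)) = zero , suc zero , λ ()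

proposition16 : (k : ℕ) → 1 ≤ k → (G : Multigraph) → ExactlyEdgeConnected G k →
    Σ (Fin (Multigraph.n G)) (λ u → Σ (Fin (Multigraph.n G)) (λ v →
      u ≢ v × degree G u ≡ k × degree G v ≡ k))
proposition16 k _ G (2≤n , exact) =
  let u , v , u≢v                          = two-distinct 2≤n
      w , w′ , w≢w′ , w-tight , w′-tight = two-tight-singletons k at-least at-most u≢v
  in  w , w′ , w≢w′ , degree≡k w-tight (w≢w′ ∘ sym) , degree≡k w′-tight w≢w′
  where
  open Cuts G
  open Menger G
  open SymmetricSubmodular cut cut-cong cut-∁ cut-submodular
  at-least : ∀ X {u v} → Separates X u v → k ≤ cut X
  at-least X {u} {v} sep = disjointPaths⇒≤cut {X = X} (proj₁ (exact u v (separates⇒≢ sep))) sep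
  at-most : ∀ {u v} → u ≢ v → ∃ λ X → Separates X u v × cut X ≤ k
  at-most {u} {v} u≢v = menger u v k (proj₂ (exact u v u≢v))
  degree≡k : ∀ {w w′} → cut ⁅ w ⁆ ≤ k → w′ ≢ w → degree G w ≡ k
  degree≡k {w} {w′} tight w′≢w =
    trans (degree≡cut w) (≤-antisym tight (at-least ⁅ w ⁆ {w} {w′} (⁅⁆-self w , ⁅⁆-other w′≢w)))
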